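{- Let $y$ be a type on a set $\bar T$ of Platonic vertices and let $\bar T_3\subseteq\bar T_2\subseteq\bar T_1\subseteq\bar T$. Define \[ \bar F_1=\binom{\bar T_1}{2},\quad \bar F_2=\binom{\bar T_1}{2}\setminus[\bar T_1\setminus\bar T_2,\bar T_3],\quad \bar F_3=\binom{\bar T_2}{2},\quad \bar F_4=\binom{\bar T_3}{2}\cup[\bar T_2\setminus\bar T_3,\bar T_3]. \] Then \[ \mathrm{coi}(\bar T_1,\bar T_2,y)=\mathrm{coi}(\bar T_1\setminus\bar T_3,\bar T_2\setminus\bar T_3,y)+\mathrm{edgcoi}(\bar F_1,\bar F_2,y)+\nu(\bar F_2,\bar F_3,\bar F_4,y), \] and \[ \mathrm{pow}(\bar T_1,\bar T_2,y)=\mathrm{pow}(\bar T_1\setminus\bar T_3,\bar T_2\setminus\bar T_3,y)-\frac{p-2}{Q}\Big[\mathrm{edgcoi}(\bar F_1,\bar F_2,y)+\nu(\bar F_2,\bar F_3,\bar F_4,y)\Big]. \]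
   Context: Fix integers $p\ge3$, $q\in\{1,\dots,\binom p2\}$, and write $Q=\binom p2-q+1$. Let $C$ be a set of "real colors", $\bar V$ a set of $2p$ "Platonic vertices", and $\bar C$ a set (disjoint from $C$) of "Platonic colors". A type on $\bar S\subseteq\bar V$ is a labeling $z$ of $\binom{\bar S}{2}$ in which each label is one of: $\mathrm{col}(c)$ for some $c\in C\cup\bar C$, $\mathrm{unc}(c)$ for some $c\in C\cup\bar C$, $\mathrm{unc}(?)$, or $\mathrm{wild}$. For sets $A,B$ of vertices, $[A,B]$ denotes the set of edges with one endpoint in $A$ and the other in $B$. For a type $z$ on $\bar S$ and edge sets $\bar E'\subseteq\bar E\subseteq\binom{\bar S}{2}$: $M(\bar E,\bar E',z)$ is the set of edges of $\bar E\setminus\bar E'$ labeled $\mathrm{col}(\cdot)$; $\mathrm{free}(\bar E,\bar E',z)$ is the set of Platonic colors $c$ such that some edge of $\bar E\setminus\bar E'$ is labeled $\mathrm{col}(c)$ but no edge of $\bar E'$ is labeled $\mathrm{col}(c)$; and $\mathrm{edgcoi}(\bar E,\bar E',z)=|M(\bar E,\bar E',z)|-|\mathrm{free}(\bar E,\bar E',z)|$. For $\bar S'\subseteq\bar S$, $\mathrm{coi}(\bar S,\bar S',z)=\mathrm{edgcoi}(\binom{\bar S}{2},\binom{\bar S'}{2},z)$ and $\mathrm{pow}(\bar S,\bar S',z)=|\bar S\setminus\bar S'|-\frac{p-2}{Q}\mathrm{coi}(\bar S,\bar S',z)$. For edge sets $\bar E_3\subseteq\bar E_2\subseteq\bar E_1\subseteq\binom{\bar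 S}{2}$, $\nu(\bar E_1,\bar E_2,\bar E_3,z)=\big|\mathrm{free}(\bar E_1\setminus\bar E_3,\bar E_2\setminus\bar E_3,z)\setminus\mathrm{free}(\bar E_1,\bar E_2,z)\big|$. -}

module Defs where

open import Data.Bool using (Bool; true; false; _∧_; _∨_; not; if_then_else_)
open import Data.Nat using (ℕ; zero; suc; _∸_; _<?_)
open import Data.Nat.Combinatorics using (_C_)
open import Data.Fin using (Fin; toℕ; _≟_)
open import Data.Fin.Subset using (Subset; _─_; ∣_∣)
open import Data.Vec using (lookup)
open import Data.List using (List; []; _∷_; allFin; concatMap; map; filter; foldr)
open import Data.Product using (_×_; _,_)
open import Data.Sum using (_⊎_; inj₁; inj₂)
open import Data.Integer using (ℤ; +_; _-_)
open import Data.Rational using (ℚ; _/_) renaming (_-_ to _-ℚ_; _*_ to _*ℚ_)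
open import Relation.Nullary.Decidable using (⌊_⌋)

-- Labels of a type.  Real colours: an arbitrary set C.  Platonic colours: Fin m
-- (a finite set, disjoint from C via the sum type C ⊎ Fin m).
data Label (RC : Set) (m : ℕ) : Set where
  col  : RC ⊎ Fin m → Label RC m
  unc  : RC ⊎ Fin m → Label RC m
  unc? : Label RC m
  wild : Label RC m

-- A type: a labelling of pairs of Platonic vertices (Fin n, n = 2p).
-- Only the values z i j with toℕ i < toℕ j and i, j in the relevant vertex set are ever used.
TypeOn : Set → ℕ → ℕ → Set
TypeOn RC m n = Fin n → Fin n → Label RC m

-- Edge sets, as Boolean predicates on pairs (only pairs i<j are read).
EdgeSet : ℕ → Set
EdgeSet n = Fin n → Fin n → Bool

pairsIn : ∀ {n} → Subset n → EdgeSet n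
pairsIn S i j = lookup S i ∧ lookup S j

between : ∀ {n} → Subset n → Subset n → EdgeSet n
between A B i j = (lookup A i ∧ lookup B j) ∨ (lookup B i ∧ lookup A j)

_∖E_ : ∀ {n} → EdgeSet n → EdgeSet n → EdgeSet n
(E ∖E F) i j = E i j ∧ not (F i j)

_∪E_ : ∀ {n} → EdgeSet n → EdgeSet n → EdgeSet n
(E ∪E F) i j = E i j ∨ F i j

edges : (n : ℕ) → List (Fin n × Fin n)
edges n = concatMap (λ i → map (i ,_) (filter (λ j → toℕ i <? toℕ j) (allFin n))) (allFin n)

countB : ∀ {A : Set} → (A → Bool) → List A → ℕ
countB P = foldr (λ a k → if P a then suc k else k) 0

anyB : ∀ {A : Set} → (A → Bool) → List A → Bool
anyB P = foldr (λ a b → P a ∨ b) false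

isCol : ∀ {RC m} → Label RC m → Bool
isCol (col _) = true
isCol _       = false

isColPlat : ∀ {RC m} → Fin m → Label RC m → Bool
isColPlat c (col (inj₂ d)) = ⌊ d ≟ c ⌋
isColPlat c _              = false

module _ {RC : Set} {m n : ℕ} where

  countEdges : (Fin n → Fin n → Bool) → ℕ
  countEdges P = countB (λ { (i , j) → P i j }) (edges n)

  hasCol : EdgeSet n → TypeOn RC m n → Fin m → Bool
  hasCol E z c = anyB (λ { (i , j) → E i j ∧ isColPlat c (z i j) }) (edges n)

  Mcard : EdgeSet n → EdgeSet n → TypeOn RC m n → ℕ
  Mcard E E' z = countEdges (λ i j → (E ∖E E') i j ∧ isCol (z i j))

  free : EdgeSet n → EdgeSet n → TypeOn RC m n → Fin m → Bool
  free E E' z c = hasCol (E ∖E E') z c ∧ not (hasCol E' z c)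

  freeCard : EdgeSet n → EdgeSet n → TypeOn RC m n → ℕ
  freeCard E E' z = countB (free E E' z) (allFin m)

  edgcoi : EdgeSet n → EdgeSet n → TypeOn RC m n → ℤ
  edgcoi E E' z = + Mcard E E' z - + freeCard E E' z

  coi : Subset n → Subset n → TypeOn RC m n → ℤ
  coi S S' z = edgcoi (pairsIn S) (pairsIn S') z

  ν : EdgeSet n → EdgeSet n → EdgeSet n → TypeOn RC m n → ℕ
  ν E₁ E₂ E₃ z =
    countB (λ c → free (E₁ ∖E E₃) (E₂ ∖E E₃) z c ∧ not (free E₁ E₂ z c)) (allFin m)

Qval : ℕ → ℕ → ℕ
Qval p q = suc ((p C 2) ∸ q)

ratio : ℕ → ℕ → ℚ
ratio p q = (+ (p ∸ 2)) / Qval p q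

toℚ : ℤ → ℚ
toℚ k = k / 1

pow : ∀ {RC m n} → ℕ → ℕ → Subset n → Subset n → TypeOn RC m n → ℚ
pow p q S S' z = toℚ (+ ∣ S ─ S' ∣) -ℚ (ratio p q *ℚ toℚ (coi S S' z))

module Submission where

open import Defs
open import Data.Nat using (ℕ; _≤_)
open import Data.Nat.Combinatorics using (_C_)
open import Data.Fin.Subset using (Subset; _─_; _⊆_)
open import Data.Product using (_×_)
open import Data.Integer using (ℤ; +_) renaming (_+_ to _+ℤ_)
open import Data.Rational using (ℚ) renaming (_-_ to _-ℚ_; _*_ to _*ℚ_)
open import Relation.Binary.PropositionalEquality using (_≡_)

open import Algebra.Bundles using (CommutativeMonoid)
import Algebra.Properties.CommutativeSemigroup as CommutativeSemigroupProperties
open import Data.Bool using (Bool; true; false; _∧_; _∨_; not)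
import Data.Bool as Bool
open import Data.Bool.Properties using (∧-distribʳ-∨; ∧-zeroʳ; ∧-identityʳ; ∨-commutativeMonoid; ∧-commutativeMonoid)
open import Data.Fin using (Fin; zero; suc)
open import Data.Fin.Subset using (∣_∣)
open import Data.Integer using (_-_)
import Data.Integer.Properties as ℤ
import Data.Integer.Solver as ℤ-Solver
open import Data.List using (List; []; _∷_; allFin)
open import Data.List.Membership.Propositional using (_∈_)
open import Data.List.Relation.Unary.All as All using (all?)
open import Data.List.Relation.Unary.Any using (here; there)
open import Data.Nat using (suc; _+_)
import Data.Nat.Properties as ℕ
open import Data.Nat.Coprimality using (1-coprimeTo)
import Data.Nat.Coprimality as Coprimality
open import Data.Product using (_,_)
import Data.Rational as ℚ
open import Data.Rational.Properties using (↥p/↧p≡p)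
import Data.Rational.Solver as ℚ-Solver
open import Data.Vec using (_∷_; lookup)
open import Data.Vec.Properties using (tabulate∘lookup; tabulate-cong; []=⇒lookup; lookup⇒[]=)
open import Function using (case_of_)
open import Relation.Binary.PropositionalEquality using (_≗_; refl; sym; trans; cong; cong₂; module ≡-Reasoning)
open import Relation.Nullary.Decidable using (True; toWitness)

-- Since T₃ ⊆ T₂ ⊆ T₁, a vertex lies in one of four zones (outside T₁, T₁ ∖ T₂, T₂ ∖ T₃, T₃)
-- and every edge set involved is determined by the zones of its endpoints, so all identities
-- between these edge sets are checked on the sixteen zone pairs.  The coloured edges of
-- binom(T₁) ∖ binom(T₂) split into the outer edges binom(T₁∖T₃) ∖ binom(T₂∖T₃), counted by
-- the smaller coi, and the cross edges [T₁∖T₂, T₃] = F₁ ∖ F₂.  Whether a Platonic colour is free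
-- for each pair of edge sets is a Boolean function of whether it occurs on the outer edges, on
-- the cross edges, on binom(T₂∖T₃) and on F₄, and a case check shows that ν is exactly the
-- difference between free(T₁∖T₃, T₂∖T₃) + free(F₁, F₂) and free(F₁, F₃).  Together with
-- (T₁∖T₃) ∖ (T₂∖T₃) = T₁ ∖ T₂ this also gives the identity for pow.

open CommutativeSemigroupProperties ℕ.+-commutativeSemigroup
  using () renaming (interchange to +-interchange)
open CommutativeSemigroupProperties (CommutativeMonoid.commutativeSemigroup ∨-commutativeMonoid)
  using () renaming (interchange to ∨-interchange)
open CommutativeSemigroupProperties (CommutativeMonoid.commutativeSemigroup ∧-commutativeMonoid)
  using () renaming (interchange to ∧-interchange)

𝟙 : Bool → ℕ
𝟙 true  = 1
𝟙 false = 0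

module _ {A : Set} where

  countB-∷ : (P : A → Bool) (x : A) (xs : List A) → countB P (x ∷ xs) ≡ 𝟙 (P x) + countB P xs
  countB-∷ P x xs with P x
  ... | true  = refl
  ... | false = refl

  countB-cong : {P Q : A → Bool} → P ≗ Q → (xs : List A) → countB P xs ≡ countB Q xs
  countB-cong P≗Q []       = refl
  countB-cong P≗Q (x ∷ xs) rewrite P≗Q x | countB-cong P≗Q xs = refl

  countB-+ : {P Q R S : A → Bool} → (∀ x → 𝟙 (P x) + 𝟙 (Q x) ≡ 𝟙 (R x) + 𝟙 (S x)) →
             (xs : List A) → countB P xs + countB Q xs ≡ countB R xs + countB S xs
  countB-+ pointwise [] = refl
  countB-+ {P} {Q} {R} {S} pointwise (x ∷ xs) = begin
    countB P (x ∷ xs) + countB Q (x ∷ xs)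
      ≡⟨ cong₂ _+_ (countB-∷ P x xs) (countB-∷ Q x xs) ⟩
    (𝟙 (P x) + countB P xs) + (𝟙 (Q x) + countB Q xs)
      ≡⟨ +-interchange (𝟙 (P x)) (countB P xs) (𝟙 (Q x)) (countB Q xs) ⟩
    (𝟙 (P x) + 𝟙 (Q x)) + (countB P xs + countB Q xs)
      ≡⟨ cong₂ _+_ (pointwise x) (countB-+ pointwise xs) ⟩
    (𝟙 (R x) + 𝟙 (S x)) + (countB R xs + countB S xs)
      ≡⟨ +-interchange (𝟙 (R x)) (𝟙 (S x)) (countB R xs) (countB S xs) ⟩
    (𝟙 (R x) + countB R xs) + (𝟙 (S x) + countB S xs)
      ≡⟨ sym (cong₂ _+_ (countB-∷ R x xs) (countB-∷ S x xs)) ⟩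
    countB R (x ∷ xs) + countB S (x ∷ xs) ∎
    where open ≡-Reasoning

  countB-∨ : {P Q : A → Bool} → (∀ x → P x ∧ Q x ≡ false) →
             (xs : List A) → countB (λ x → P x ∨ Q x) xs ≡ countB P xs + countB Q xs
  countB-∨ disjoint [] = refl
  countB-∨ {P} {Q} disjoint (x ∷ xs) with P x | Q x | disjoint x
  ... | true  | false | _ = cong suc (countB-∨ disjoint xs)
  ... | false | true  | _ = trans (cong suc (countB-∨ disjoint xs))
                                 (sym (ℕ.+-suc (countB P xs) (countB Q xs)))
  ... | false | false | _ = countB-∨ disjoint xs

  anyB-cong : {P Q : A → Bool} → P ≗ Q → (xs : List A) → anyB P xs ≡ anyB Q xs
  anyB-cong P≗Q []       = refl
  anyB-cong P≗Q (x ∷ xs) = cong₂ _∨_ (P≗Q x) (anyB-cong P≗Q xs)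

  anyB-∨ : (P Q : A → Bool) (xs : List A) → anyB (λ x → P x ∨ Q x) xs ≡ anyB P xs ∨ anyB Q xs
  anyB-∨ P Q []       = refl
  anyB-∨ P Q (x ∷ xs) =
    trans (cong ((P x ∨ Q x) ∨_) (anyB-∨ P Q xs)) (∨-interchange (P x) (Q x) (anyB P xs) (anyB Q xs))

module _ {n : ℕ} where

  infix 4 _≐_
  _≐_ : EdgeSet n → EdgeSet n → Set
  E ≐ E′ = ∀ i j → E i j ≡ E′ i j

  Disjoint : EdgeSet n → EdgeSet n → Set
  Disjoint E E′ = ∀ i j → E i j ∧ E′ i j ≡ false

  module _ {RC : Set} {m : ℕ} (z : TypeOn RC m n) where

    colCount : EdgeSet n → ℕ
    colCount E = countEdges {RC} {m} (λ i j → E i j ∧ isCol (z i j))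

    colCount-cong : {E E′ : EdgeSet n} → E ≐ E′ → colCount E ≡ colCount E′
    colCount-cong E≐E′ = countB-cong (λ { (i , j) → cong (_∧ isCol (z i j)) (E≐E′ i j) }) (edges n)

    colCount-∪ : (A B : EdgeSet n) → Disjoint A B → colCount (A ∪E B) ≡ colCount A + colCount B
    colCount-∪ A B disjoint = trans
      (countB-cong (λ { (i , j) → ∧-distribʳ-∨ (isCol (z i j)) (A i j) (B i j) }) (edges n))
      (countB-∨ (λ { (i , j) → trans (∧-interchange (A i j) (isCol (z i j)) (B i j) (isCol (z i j)))
                                     (cong (_∧ _) (disjoint i j)) }) (edges n))

    module _ (c : Fin m) where

      hasCol-cong : {E E′ : EdgeSet n} → E ≐ E′ → hasCol E z c ≡ hasCol E′ z c
      hasCol-cong E≐E′ = anyB-cong (λ { (i , j) → cong (_∧ isColPlat c (z i j)) (E≐E′ i j) }) (edges n)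

      hasCol-∪ : (A B : EdgeSet n) → hasCol (A ∪E B) z c ≡ hasCol A z c ∨ hasCol B z c
      hasCol-∪ A B = trans
        (anyB-cong (λ { (i , j) → ∧-distribʳ-∨ (isColPlat c (z i j)) (A i j) (B i j) }) (edges n))
        (anyB-∨ _ _ (edges n))

      free-≡ : {E E′ : EdgeSet n} {u v : Bool} → hasCol (E ∖E E′) z c ≡ u → hasCol E′ z c ≡ v →
               free E E′ z c ≡ u ∧ not v
      free-≡ = cong₂ (λ u v → u ∧ not v)

lookup-─ : ∀ {n} (p q : Subset n) (i : Fin n) → lookup (p ─ q) i ≡ lookup p i ∧ not (lookup q i)
lookup-─ (x ∷ p) (true  ∷ q) zero    = sym (∧-zeroʳ x)
lookup-─ (x ∷ p) (false ∷ q) zero    = sym (∧-identityʳ x)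
lookup-─ (x ∷ p) (y     ∷ q) (suc i) = lookup-─ p q i

subset-ext : ∀ {n} {p q : Subset n} → (∀ i → lookup p i ≡ lookup q i) → p ≡ q
subset-ext {p = p} {q} pointwise =
  trans (sym (tabulate∘lookup p)) (trans (tabulate-cong pointwise) (tabulate∘lookup q))

⊆⇒lookup : ∀ {n} {p q : Subset n} → p ⊆ q → ∀ i → lookup p i ≡ true → lookup q i ≡ true
⊆⇒lookup p⊆q i i∈p = []=⇒lookup (p⊆q (lookup⇒[]= i _ i∈p))

record Profile : Set where
  constructor ⟨_,_,_,_,_,_⟩
  field
    in₁ in₂ in₃ in₁∖₃ in₂∖₃ in₁∖₂ : Bool

open Profile

-- One profile per zone: outside T₁, in T₁ ∖ T₂, in T₂ ∖ T₃, in T₃.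
nestedProfiles : List Profile
nestedProfiles =
  ⟨ false , false , false , false , false , false ⟩ ∷
  ⟨ true  , false , false , true  , false , true  ⟩ ∷
  ⟨ true  , true  , false , true  , true  , false ⟩ ∷
  ⟨ true  , true  , true  , false , false , false ⟩ ∷ []

nestedProfile : ∀ a₁ a₂ a₃ → (a₃ ≡ true → a₂ ≡ true) → (a₂ ≡ true → a₁ ≡ true) →
  ⟨ a₁ , a₂ , a₃ , a₁ ∧ not a₃ , a₂ ∧ not a₃ , a₁ ∧ not a₂ ⟩ ∈ nestedProfiles
nestedProfile false false false _ _ = here refl
nestedProfile true  false false _ _ = there (here refl)
nestedProfile true  true  false _ _ = there (there (here refl))
nestedProfile true  true  true  _ _ = there (there (there (here refl)))
nestedProfile false true  _ _ 2⊆1 = case 2⊆1 refl of λ ()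
nestedProfile _     false true 3⊆2 _ = case 3⊆2 refl of λ ()

-- An edge set described through the profiles of its endpoints; ⟦_⟧ below interprets a schema
-- for a concrete chain, and ⟦ F₂ ⟧ etc. unfold definitionally to the edge sets of the statement.
Schema : Set
Schema = Profile → Profile → Bool

pairsₛ : (Profile → Bool) → Schema
pairsₛ S u v = S u ∧ S v

betweenₛ : (Profile → Bool) → (Profile → Bool) → Schema
betweenₛ A B u v = (A u ∧ B v) ∨ (B u ∧ A v)

_∖ₛ_ : Schema → Schema → Schema
(E ∖ₛ E′) u v = E u v ∧ not (E′ u v)

_∪ₛ_ : Schema → Schema → Schema
(E ∪ₛ E′) u v = E u v ∨ E′ u v

agreeOnNested : (f g : Profile → Bool) →
  {True (all? (λ u → f u Bool.≟ g u) nestedProfiles)} →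
  ∀ {u} → u ∈ nestedProfiles → f u ≡ g u
agreeOnNested f g {checked} = All.lookup (toWitness checked)

-- For concrete schemas this check evaluates to ⊤, so the implicit proof is found automatically.
AgreeOnNested₂ : Schema → Schema → Set
AgreeOnNested₂ f g = True (all? (λ u → all? (λ v → f u v Bool.≟ g u v) nestedProfiles) nestedProfiles)

agreeOnNested₂ : (f g : Schema) → {AgreeOnNested₂ f g} →
  ∀ {u v} → u ∈ nestedProfiles → v ∈ nestedProfiles → f u v ≡ g u v
agreeOnNested₂ f g {checked} u∈ v∈ = All.lookup (All.lookup (toWitness checked) u∈) v∈

-- toℚ k equals the already normal mkℚ k 0, and ℚ-addition of two such numbers is by definition
-- (k * 1 + l * 1) / 1.
toℚ-+ : ∀ a b → toℚ (a +ℤ b) ≡ toℚ a ℚ.+ toℚ b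
toℚ-+ a b = sym (trans (cong₂ ℚ._+_ (as-mkℚ a) (as-mkℚ b))
  (cong (ℚ._/ 1) (cong₂ _+ℤ_ (ℤ.*-identityʳ a) (ℤ.*-identityʳ b))))
  where
  as-mkℚ : ∀ k → toℚ k ≡ ℚ.mkℚ k 0 (Coprimality.sym (1-coprimeTo _))
  as-mkℚ k = ↥p/↧p≡p (ℚ.mkℚ k 0 (Coprimality.sym (1-coprimeTo _)))

difference-split : ∀ {M f Mₐ Mᵦ fₐ fᵦ v : ℕ} → M ≡ Mₐ + Mᵦ → f + v ≡ fₐ + fᵦ →
  + M - + f ≡ (+ Mₐ - + fₐ) +ℤ (+ Mᵦ - + fᵦ) +ℤ + v
difference-split {f = f} {Mₐ} {Mᵦ} {fₐ} {fᵦ} {v} refl f+v≡fₐ+fᵦ = begin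
  + (Mₐ + Mᵦ) - + f
    ≡⟨ cong (_- + f) (ℤ.pos-+ Mₐ Mᵦ) ⟩
  (+ Mₐ +ℤ + Mᵦ) - + f
    ≡⟨ solve 4 (λ a b c e → (a :+ b) :- c := (a :+ b) :- (c :+ e) :+ e) refl (+ Mₐ) (+ Mᵦ) (+ f) (+ v) ⟩
  (+ Mₐ +ℤ + Mᵦ) - (+ f +ℤ + v) +ℤ + v
    ≡⟨ cong (λ w → (+ Mₐ +ℤ + Mᵦ) - w +ℤ + v)
         (trans (sym (ℤ.pos-+ f v)) (trans (cong +_ f+v≡fₐ+fᵦ) (ℤ.pos-+ fₐ fᵦ))) ⟩
  (+ Mₐ +ℤ + Mᵦ) - (+ fₐ +ℤ + fᵦ) +ℤ + v
    ≡⟨ solve 5 (λ a b c d e → (a :+ b) :- (c :+ d) :+ e := (a :- c) :+ (b :- d) :+ e)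
         refl (+ Mₐ) (+ Mᵦ) (+ fₐ) (+ fᵦ) (+ v) ⟩
  (+ Mₐ - + fₐ) +ℤ (+ Mᵦ - + fᵦ) +ℤ + v ∎
  where
  open ≡-Reasoning
  open ℤ-Solver.+-*-Solver using (solve; _:+_; _:-_; _:=_)

pow-by-coi : ∀ p q {RC m n} {S S′ U U′ : Subset n} (z : TypeOn RC m n) (X : ℤ) →
  S ─ S′ ≡ U ─ U′ → coi S S′ z ≡ coi U U′ z +ℤ X →
  pow p q S S′ z ≡ pow p q U U′ z -ℚ ratio p q *ℚ toℚ X
pow-by-coi p q {S = S} {S′} {U} {U′} z X same-difference coi-split = begin
  toℚ (+ ∣ S ─ S′ ∣) -ℚ r *ℚ toℚ (coi S S′ z)
    ≡⟨ cong₂ (λ D k → toℚ (+ ∣ D ∣) -ℚ r *ℚ toℚ k) same-difference coi-split ⟩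
  toℚ (+ ∣ U ─ U′ ∣) -ℚ r *ℚ toℚ (coi U U′ z +ℤ X)
    ≡⟨ cong (λ k → toℚ (+ ∣ U ─ U′ ∣) -ℚ r *ℚ k) (toℚ-+ (coi U U′ z) X) ⟩
  toℚ (+ ∣ U ─ U′ ∣) -ℚ r *ℚ (toℚ (coi U U′ z) ℚ.+ toℚ X)
    ≡⟨ solve 4 (λ d r a x → d :- r :* (a :+ x) := (d :- r :* a) :- r :* x)
         refl (toℚ (+ ∣ U ─ U′ ∣)) r (toℚ (coi U U′ z)) (toℚ X) ⟩
  pow p q U U′ z -ℚ r *ℚ toℚ X ∎
  where
  r = ratio p q
  open ≡-Reasoning
  open ℚ-Solver.+-*-Solver using (solve; _:+_; _:-_; _:*_; _:=_)

𝟙-free-exchange : ∀ a b s f →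
  𝟙 ((a ∨ b) ∧ not (s ∨ f)) + 𝟙 ((a ∧ not s) ∧ not (a ∧ not (s ∨ f)))
    ≡ 𝟙 (a ∧ not s) + 𝟙 (b ∧ not (a ∨ (s ∨ f)))
𝟙-free-exchange false b     s     f     = ℕ.+-identityʳ _
𝟙-free-exchange true  true  true  true  = refl
𝟙-free-exchange true  true  true  false = refl
𝟙-free-exchange true  true  false true  = refl
𝟙-free-exchange true  true  false false = refl
𝟙-free-exchange true  false true  true  = refl
𝟙-free-exchange true  false true  false = refl
𝟙-free-exchange true  false false true  = refl
𝟙-free-exchange true  false false false = refl

module NestedChain {n : ℕ} (T₁ T₂ T₃ : Subset n) (T₃⊆T₂ : T₃ ⊆ T₂) (T₂⊆T₁ : T₂ ⊆ T₁) where

  profile : Fin n → Profile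
  profile i = ⟨ lookup T₁ i , lookup T₂ i , lookup T₃ i ,
                lookup (T₁ ─ T₃) i , lookup (T₂ ─ T₃) i , lookup (T₁ ─ T₂) i ⟩

  profile-nested : ∀ i → profile i ∈ nestedProfiles
  profile-nested i rewrite lookup-─ T₁ T₃ i | lookup-─ T₂ T₃ i | lookup-─ T₁ T₂ i =
    nestedProfile _ _ _ (⊆⇒lookup T₃⊆T₂ i) (⊆⇒lookup T₂⊆T₁ i)

  ⟦_⟧ : Schema → EdgeSet n
  ⟦ E ⟧ i j = E (profile i) (profile j)

  F₁ F₂ F₃ F₄ outer cross inner : Schema
  F₁    = pairsₛ in₁
  F₂    = pairsₛ in₁ ∖ₛ betweenₛ in₁∖₂ in₃
  F₃    = pairsₛ in₂
  F₄    = pairsₛ in₃ ∪ₛ betweenₛ in₂∖₃ in₃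
  outer = pairsₛ in₁∖₃ ∖ₛ pairsₛ in₂∖₃
  cross = betweenₛ in₁∖₂ in₃
  inner = pairsₛ in₂∖₃

  difference-of-differences : T₁ ─ T₂ ≡ (T₁ ─ T₃) ─ (T₂ ─ T₃)
  difference-of-differences = subset-ext λ i → trans
    (agreeOnNested in₁∖₂ (λ u → in₁∖₃ u ∧ not (in₂∖₃ u)) (profile-nested i))
    (sym (lookup-─ (T₁ ─ T₃) (T₂ ─ T₃) i))

  by-zones : (E E′ : Schema) → {AgreeOnNested₂ E E′} → ⟦ E ⟧ ≐ ⟦ E′ ⟧
  by-zones E E′ {agree} i j = agreeOnNested₂ E E′ {agree} (profile-nested i) (profile-nested j)

  outer-cross-disjoint : Disjoint ⟦ outer ⟧ ⟦ cross ⟧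
  outer-cross-disjoint = by-zones (outer ∧ₛ cross) (λ _ _ → false)
    where
    _∧ₛ_ : Schema → Schema → Schema
    (A ∧ₛ B) u v = A u v ∧ B u v

  module _ {RC : Set} {m : ℕ} (y : TypeOn RC m n) where

    Mcard-split : Mcard ⟦ F₁ ⟧ ⟦ F₃ ⟧ y ≡ Mcard ⟦ pairsₛ in₁∖₃ ⟧ ⟦ inner ⟧ y + Mcard ⟦ F₁ ⟧ ⟦ F₂ ⟧ y
    Mcard-split = begin
      colCount y ⟦ F₁ ∖ₛ F₃ ⟧
        ≡⟨ colCount-cong y (by-zones (F₁ ∖ₛ F₃) (outer ∪ₛ cross)) ⟩
      colCount y ⟦ outer ∪ₛ cross ⟧
        ≡⟨ colCount-∪ y ⟦ outer ⟧ ⟦ cross ⟧ outer-cross-disjoint ⟩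
      colCount y ⟦ outer ⟧ + colCount y ⟦ cross ⟧
        ≡⟨ cong (λ k → colCount y ⟦ outer ⟧ + k) (colCount-cong y (by-zones cross (F₁ ∖ₛ F₂))) ⟩
      colCount y ⟦ outer ⟧ + colCount y ⟦ F₁ ∖ₛ F₂ ⟧ ∎
      where open ≡-Reasoning

    module _ (c : Fin m) where

      private
        has : Schema → Bool
        has E = hasCol ⟦ E ⟧ y c

      has-∪ : (E A B : Schema) → {AgreeOnNested₂ E (A ∪ₛ B)} → has E ≡ has A ∨ has B
      has-∪ E A B {agree} = trans (hasCol-cong y c (by-zones E (A ∪ₛ B) {agree})) (hasCol-∪ y c ⟦ A ⟧ ⟦ B ⟧)

      has-≐ : (E A : Schema) → {AgreeOnNested₂ E A} → has E ≡ has A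
      has-≐ E A {agree} = hasCol-cong y c (by-zones E A {agree})

      has-F₃ : has F₃ ≡ has inner ∨ has F₄
      has-F₃ = has-∪ F₃ inner F₄

      free-F₁F₃ : free ⟦ F₁ ⟧ ⟦ F₃ ⟧ y c ≡ (has outer ∨ has cross) ∧ not (has inner ∨ has F₄)
      free-F₁F₃ = free-≡ y c (has-∪ (F₁ ∖ₛ F₃) outer cross) has-F₃

      free-F₁F₂ : free ⟦ F₁ ⟧ ⟦ F₂ ⟧ y c ≡ has cross ∧ not (has outer ∨ (has inner ∨ has F₄))
      free-F₁F₂ = free-≡ y c (has-≐ (F₁ ∖ₛ F₂) cross)
        (trans (has-∪ F₂ outer F₃) (cong (has outer ∨_) has-F₃))

      free-F₂F₃ : free ⟦ F₂ ⟧ ⟦ F₃ ⟧ y c ≡ has outer ∧ not (has inner ∨ has F₄)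
      free-F₂F₃ = free-≡ y c (has-≐ (F₂ ∖ₛ F₃) outer) has-F₃

      free-F₂F₃∖F₄ : free ⟦ F₂ ∖ₛ F₄ ⟧ ⟦ F₃ ∖ₛ F₄ ⟧ y c ≡ has outer ∧ not (has inner)
      free-F₂F₃∖F₄ = free-≡ y c (has-≐ ((F₂ ∖ₛ F₄) ∖ₛ (F₃ ∖ₛ F₄)) outer) (has-≐ (F₃ ∖ₛ F₄) inner)

      free-exchange :
        𝟙 (free ⟦ F₁ ⟧ ⟦ F₃ ⟧ y c) + 𝟙 (free ⟦ F₂ ∖ₛ F₄ ⟧ ⟦ F₃ ∖ₛ F₄ ⟧ y c ∧ not (free ⟦ F₂ ⟧ ⟦ F₃ ⟧ y c))
          ≡ 𝟙 (free ⟦ pairsₛ in₁∖₃ ⟧ ⟦ inner ⟧ y c) + 𝟙 (free ⟦ F₁ ⟧ ⟦ F₂ ⟧ y c)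
      free-exchange = begin
        𝟙 (free ⟦ F₁ ⟧ ⟦ F₃ ⟧ y c) + 𝟙 (free ⟦ F₂ ∖ₛ F₄ ⟧ ⟦ F₃ ∖ₛ F₄ ⟧ y c ∧ not (free ⟦ F₂ ⟧ ⟦ F₃ ⟧ y c))
          ≡⟨ cong₂ (λ u v → 𝟙 u + 𝟙 v) free-F₁F₃ (cong₂ (λ u v → u ∧ not v) free-F₂F₃∖F₄ free-F₂F₃) ⟩
        𝟙 ((a ∨ b) ∧ not (s ∨ f)) + 𝟙 ((a ∧ not s) ∧ not (a ∧ not (s ∨ f)))
          ≡⟨ 𝟙-free-exchange a b s f ⟩
        𝟙 (a ∧ not s) + 𝟙 (b ∧ not (a ∨ (s ∨ f)))
          ≡⟨ cong (λ u → 𝟙 (a ∧ not s) + 𝟙 u) (sym free-F₁F₂) ⟩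
        𝟙 (free ⟦ pairsₛ in₁∖₃ ⟧ ⟦ inner ⟧ y c) + 𝟙 (free ⟦ F₁ ⟧ ⟦ F₂ ⟧ y c) ∎
        where
        open ≡-Reasoning
        a = has outer
        b = has cross
        s = has inner
        f = has F₄

    freeCard-split : freeCard ⟦ F₁ ⟧ ⟦ F₃ ⟧ y + ν ⟦ F₂ ⟧ ⟦ F₃ ⟧ ⟦ F₄ ⟧ y
                   ≡ freeCard ⟦ pairsₛ in₁∖₃ ⟧ ⟦ inner ⟧ y + freeCard ⟦ F₁ ⟧ ⟦ F₂ ⟧ y
    freeCard-split = countB-+ free-exchange (allFin m)

    coi-split : coi T₁ T₂ y ≡ coi (T₁ ─ T₃) (T₂ ─ T₃) y +ℤ edgcoi ⟦ F₁ ⟧ ⟦ F₂ ⟧ y +ℤ + ν ⟦ F₂ ⟧ ⟦ F₃ ⟧ ⟦ F₄ ⟧ y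
    coi-split = difference-split {f = freeCard ⟦ F₁ ⟧ ⟦ F₃ ⟧ y} {fₐ = freeCard ⟦ pairsₛ in₁∖₃ ⟧ ⟦ inner ⟧ y}
      Mcard-split freeCard-split

    excess : ℤ
    excess = edgcoi ⟦ F₁ ⟧ ⟦ F₂ ⟧ y +ℤ + ν ⟦ F₂ ⟧ ⟦ F₃ ⟧ ⟦ F₄ ⟧ y

    pow-split : ∀ p q → pow p q T₁ T₂ y ≡ pow p q (T₁ ─ T₃) (T₂ ─ T₃) y -ℚ ratio p q *ℚ toℚ excess
    pow-split p q = pow-by-coi p q y excess difference-of-differences (trans coi-split
      (ℤ.+-assoc (coi (T₁ ─ T₃) (T₂ ─ T₃) y) (edgcoi ⟦ F₁ ⟧ ⟦ F₂ ⟧ y) (+ ν ⟦ F₂ ⟧ ⟦ F₃ ⟧ ⟦ F₄ ⟧ y)))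

lemma9p4 : (p q : ℕ) → 3 ≤ p → 1 ≤ q → q ≤ p C 2 →
    (RC : Set) (m : ℕ) (y : TypeOn RC m (2 Data.Nat.* p))
    (T T₁ T₂ T₃ : Subset (2 Data.Nat.* p)) →
    T₃ ⊆ T₂ → T₂ ⊆ T₁ → T₁ ⊆ T →
    let F₁ = pairsIn T₁
        F₂ = pairsIn T₁ ∖E between (T₁ ─ T₂) T₃
        F₃ = pairsIn T₂
        F₄ = pairsIn T₃ ∪E between (T₂ ─ T₃) T₃
    in (coi T₁ T₂ y ≡ coi (T₁ ─ T₃) (T₂ ─ T₃) y +ℤ edgcoi F₁ F₂ y +ℤ + ν F₂ F₃ F₄ y)
     × (pow p q T₁ T₂ y ≡ pow p q (T₁ ─ T₃) (T₂ ─ T₃) y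
          -ℚ ratio p q *ℚ toℚ (edgcoi F₁ F₂ y +ℤ + ν F₂ F₃ F₄ y))
lemma9p4 p q _ _ _ RC m y T T₁ T₂ T₃ T₃⊆T₂ T₂⊆T₁ _ = coi-split y , pow-split y p q
  where open NestedChain T₁ T₂ T₃ T₃⊆T₂ T₂⊆T₁
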